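{- Let $m \ge 1$ and $n_1,\dots,n_m \ge 2$ be integers, and let $H_{n_1,\dots,n_m} = K_{n_1} \times K_{n_2} \times \cdots \times K_{n_m}$ be the Hamming graph. Then $$M_N(H_{n_1,\dots,n_m}) = \prod_{i=1}^{m} n_i\Big[\sum_{i=1}^{m}(n_i-1)^4 + 3\sum_{i\ne j}(n_i-1)^2(n_j-1)^2 + 6\sum_{i,j,k \text{ distinct}}(n_i-1)^2(n_j-1)(n_k-1) + 4\sum_{i \ne j}(n_i-1)^3(n_j-1) + \sum_{i,j,k,l \text{ distinct}}(n_i-1)(n_j-1)(n_k-1)(n_l-1)\Big],$$ where each sum runs over ordered tuples of pairwise distinct indices from $\{1,\dots,m\}$ (empty sums are $0$).
   Context: $K_n$ is the complete graph on $n$ vertices. The Hamming graph $H_{n_1,\dots,n_m}$ has as vertices the $m$-tuples $(b_1,\dots,b_m)$ with $b_i \in \{0,1,\dots,n_i-1\}$, two tuples being adjacent iff they differ in exactly one coordinate; equivalently it is the Cartesian product $K_{n_1}\times\cdots\times K_{n_m}$. For a finite simple graph $G$, $\deg_G(v)$ is the degree of $v$, $\delta_G(v) = \sum_{u \in N_G(v)} \deg_G(u)$ where $N_G(v)$ is the set of neighbours of $v$, and the Neighbourhood Zagreb index is $M_N(G) = \sum_{v \in V(G)} \delta_G(v)^2$. -}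

module Defs where

open import Data.Nat using (ℕ; zero; suc; _+_; _*_; _∸_; _^_; _≡ᵇ_)
open import Data.Bool using (Bool; true; false; if_then_else_; not)
open import Data.Fin using (Fin; toℕ)
open import Data.Vec using (Vec; []; _∷_; lookup; toList)
open import Data.List using (List; []; _∷_; [_]; map; concatMap; upTo; allFin; length)
open import Data.Nat.ListAction using (sum; product)
open import Data.List using () renaming (filterᵇ to filterB)

-- Finite simple graphs, given by an explicit list of (distinct) vertices
-- and a Boolean adjacency relation.

record FinGraph : Set₁ where
  field
    V     : Set
    verts : List V
    adj   : V → V → Bool

module _ (G : FinGraph) where
  open FinGraph G

  deg : V → ℕ
  deg v = length (filterB (adj v) verts)

  δ : V → ℕ
  δ v = sum (map deg (filterB (adj v) verts))

  MN : ℕ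
  MN = sum (map (λ v → δ v ^ 2) verts)

tuples : ∀ {m} → Vec ℕ m → List (Vec ℕ m)
tuples []       = [ [] ]
tuples (n ∷ ns) = concatMap (λ b → map (b ∷_) (tuples ns)) (upTo n)

hdist : ∀ {m} → Vec ℕ m → Vec ℕ m → ℕ
hdist []       []       = 0
hdist (x ∷ xs) (y ∷ ys) = (if x ≡ᵇ y then 0 else 1) + hdist xs ys

Hamming : ∀ {m} → Vec ℕ m → FinGraph
Hamming {m} ns = record
  { V     = Vec ℕ m
  ; verts = tuples ns
  ; adj   = λ b c → hdist b c ≡ᵇ 1
  }

_≠ᶠ_ : ∀ {m} → Fin m → Fin m → Bool
i ≠ᶠ j = not (toℕ i ≡ᵇ toℕ j)

Σ₁ : (m : ℕ) → (Fin m → ℕ) → ℕ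
Σ₁ m f = sum (map f (allFin m))

Σ₂ : (m : ℕ) → (Fin m → Fin m → ℕ) → ℕ
Σ₂ m f = Σ₁ m λ i → Σ₁ m λ j → if i ≠ᶠ j then f i j else 0

Σ₃ : (m : ℕ) → (Fin m → Fin m → Fin m → ℕ) → ℕ
Σ₃ m f = Σ₁ m λ i → Σ₁ m λ j → Σ₁ m λ k →
  if (i ≠ᶠ j) Data.Bool.∧ (i ≠ᶠ k) Data.Bool.∧ (j ≠ᶠ k) then f i j k else 0

Σ₄ : (m : ℕ) → (Fin m → Fin m → Fin m → Fin m → ℕ) → ℕ
Σ₄ m f = Σ₁ m λ i → Σ₁ m λ j → Σ₁ m λ k → Σ₁ m λ l →
  if (i ≠ᶠ j) Data.Bool.∧ (i ≠ᶠ k) Data.Bool.∧ (i ≠ᶠ l)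
     Data.Bool.∧ (j ≠ᶠ k) Data.Bool.∧ (j ≠ᶠ l) Data.Bool.∧ (k ≠ᶠ l)
  then f i j k l else 0

hammingRHS : ∀ {m} → Vec ℕ m → ℕ
hammingRHS {m} ns =
  product (toList ns) *
    ( Σ₁ m (λ i → a i ^ 4)
    + 3 * Σ₂ m (λ i j → a i ^ 2 * a j ^ 2)
    + 6 * Σ₃ m (λ i j k → a i ^ 2 * a j * a k)
    + 4 * Σ₂ m (λ i j → a i ^ 3 * a j)
    + Σ₄ m (λ i j k l → a i * a j * a k * a l) )
  where
    a : Fin m → ℕ
    a i = lookup ns i ∸ 1

module Submission where

-- H is regular: a tuple v has exactly one tuple at Hamming distance 0
-- (itself) and exactly D = Σ_i (n_i - 1) tuples at distance 1.  In an
-- r-regular graph every δ(v) equals r·r, so M_N(H) = |V(H)|·D⁴, and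
-- |V(H)| = Π_i n_i.  The bracket of the corollary is the multinomial
-- expansion of D⁴ = (Σ_i a_i)⁴ with a_i = n_i - 1, grouped by the pattern of
-- equal indices; it is proved by induction on m, splitting each sum over
-- distinct index tuples of Fin (1 + m) according to which position (if any)
-- holds the index 0, with the expansions of (Σ a_i)² and (Σ a_i)³ as
-- companions.

open import Defs
open import Data.Nat using (ℕ; zero; suc; _+_; _*_; _∸_; _^_; _≡ᵇ_; _≤_; _<_; s≤s)
open import Data.Nat.Properties using (+-assoc; +-comm; *-comm; *-assoc; *-zeroʳ; *-identityʳ; *-distribˡ-+)
open import Data.Nat.Solver using (module +-*-Solver)
open import Data.Nat.Tactic.RingSolver using (solve-∀)
open import Data.Nat.ListAction using (sum; product)
open import Data.Bool using (Bool; true; false; if_then_else_; _∧_)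
open import Data.Bool.Properties using (∧-identityʳ)
open import Data.Fin using (Fin; zero; suc)
open import Data.Vec using (Vec; []; _∷_; lookup; toList)
open import Data.Vec.Relation.Binary.Pointwise.Inductive using (Pointwise; []; _∷_)
open import Data.List using (List; []; _∷_; [_]; _++_; map; concatMap; applyUpTo; upTo; allFin; length)
open import Data.List using () renaming (filterᵇ to filterB)
open import Data.List.Properties using (map-cong; map-tabulate; map-applyUpTo; length-map; length-++; length-upTo; filter-++)
open import Data.List.Relation.Unary.All as All using (All; []; _∷_)
open import Data.List.Relation.Unary.All.Properties using (concat⁺; map⁺; applyUpTo⁺₁; filter⁺)
open import Function using (id; _∘_)
open import Relation.Nullary.Decidable using (T?)
open import Relation.Binary.PropositionalEquality using (_≡_; refl; sym; trans; cong; cong₂; module ≡-Reasoning)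

open ≡-Reasoning

private variable
  A B : Set
  m : ℕ

+-interchange : ∀ a b c d → (a + b) + (c + d) ≡ (a + c) + (b + d)
+-interchange = solve-∀

sum-map-+ : (f g : A → ℕ) (l : List A) →
  sum (map (λ x → f x + g x) l) ≡ sum (map f l) + sum (map g l)
sum-map-+ f g []      = refl
sum-map-+ f g (x ∷ l) = trans (cong (f x + g x +_) (sum-map-+ f g l))
                              (+-interchange (f x) (g x) _ _)

sum-map-*ˡ : (c : ℕ) (f : A → ℕ) (l : List A) → sum (map (λ x → c * f x) l) ≡ c * sum (map f l)
sum-map-*ˡ c f []      = sym (*-zeroʳ c)
sum-map-*ˡ c f (x ∷ l) = trans (cong (c * f x +_) (sum-map-*ˡ c f l))
                               (sym (*-distribˡ-+ c (f x) _))

sum-map-0 : (l : List A) → sum (map (λ _ → 0) l) ≡ 0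
sum-map-0 []      = refl
sum-map-0 (_ ∷ l) = sum-map-0 l

sum-map-const : {f : A → ℕ} {c : ℕ} (l : List A) → All (λ x → f x ≡ c) l → sum (map f l) ≡ length l * c
sum-map-const []      []       = refl
sum-map-const (x ∷ l) (fx ∷ fl) = cong₂ _+_ fx (sum-map-const l fl)

Σ₁-cong : ∀ m {f g : Fin m → ℕ} → (∀ i → f i ≡ g i) → Σ₁ m f ≡ Σ₁ m g
Σ₁-cong m eq = cong sum (map-cong eq (allFin m))

Σ₁-suc : ∀ m (f : Fin (suc m) → ℕ) → Σ₁ (suc m) f ≡ f zero + Σ₁ m (f ∘ suc)
Σ₁-suc m f = cong (λ l → f zero + sum l)
  (trans (map-tabulate suc f) (sym (map-tabulate id (f ∘ suc))))

Σ₁-+ : ∀ m (f g : Fin m → ℕ) → Σ₁ m (λ i → f i + g i) ≡ Σ₁ m f + Σ₁ m g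
Σ₁-+ m f g = sum-map-+ f g (allFin m)

Σ₁-scale : ∀ m c {f g : Fin m → ℕ} → (∀ i → f i ≡ c * g i) → Σ₁ m f ≡ c * Σ₁ m g
Σ₁-scale m c {g = g} eq = trans (Σ₁-cong m eq) (sum-map-*ˡ c g (allFin m))

guard : Bool → ℕ → ℕ
guard b x = if b then x else 0

guard-+ : ∀ b x y → guard b (x + y) ≡ guard b x + guard b y
guard-+ true  x y = refl
guard-+ false x y = refl

guard-* : ∀ b c x → guard b (c * x) ≡ c * guard b x
guard-* true  c x = refl
guard-* false c x = sym (*-zeroʳ c)

Σ₁-guard : ∀ m b (f : Fin m → ℕ) → Σ₁ m (λ i → guard b (f i)) ≡ guard b (Σ₁ m f)
Σ₁-guard m true  f = refl
Σ₁-guard m false f = sum-map-0 (allFin m)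

-- Regrouping the distinctness tests of Σ₃ and Σ₄: the tests not involving
-- the last index come first.
guard-split₃ : ∀ a b c x → guard (a ∧ b ∧ c) x ≡ guard a (guard (b ∧ c ∧ true) x)
guard-split₃ false b c x = refl
guard-split₃ true  b c x = cong (λ t → guard (b ∧ t) x) (sym (∧-identityʳ c))

guard-split₄ : ∀ ij ik il jk jl kl x →
  guard (ij ∧ ik ∧ il ∧ jk ∧ jl ∧ kl) x ≡ guard (ij ∧ ik ∧ jk) (guard (il ∧ jl ∧ kl ∧ true) x)
guard-split₄ false ik    il    jk    jl kl x = refl
guard-split₄ true  false il    jk    jl kl x = refl
guard-split₄ true  true  false false jl kl x = refl
guard-split₄ true  true  false true  jl kl x = refl
guard-split₄ true  true  true  false jl kl x = refl
guard-split₄ true  true  true  true  jl kl x = cong (λ t → guard (jl ∧ t) x) (sym (∧-identityʳ kl))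

avoid : List (Fin m) → Fin m → Bool
avoid []       l = true
avoid (x ∷ xs) l = (x ≠ᶠ l) ∧ avoid xs l

Σ∉ : (m : ℕ) → List (Fin m) → (Fin m → ℕ) → ℕ
Σ∉ m xs f = Σ₁ m (λ l → guard (avoid xs l) (f l))

avoid-suc : (xs : List (Fin m)) (l : Fin m) → avoid (map suc xs) (suc l) ≡ avoid xs l
avoid-suc []       l = refl
avoid-suc (x ∷ xs) l = cong ((x ≠ᶠ l) ∧_) (avoid-suc xs l)

avoid-suc-zero : (xs : List (Fin m)) → avoid (map suc xs) zero ≡ true
avoid-suc-zero []       = refl
avoid-suc-zero (x ∷ xs) = avoid-suc-zero xs

avoid-hole-zero : (as bs : List (Fin m)) → avoid (map suc as ++ zero ∷ map suc bs) zero ≡ false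
avoid-hole-zero []       bs = refl
avoid-hole-zero (a ∷ as) bs = avoid-hole-zero as bs

avoid-hole-suc : (as bs : List (Fin m)) (l : Fin m) →
  avoid (map suc as ++ zero ∷ map suc bs) (suc l) ≡ avoid (as ++ bs) l
avoid-hole-suc []       bs l = avoid-suc bs l
avoid-hole-suc (a ∷ as) bs l = cong ((a ≠ᶠ l) ∧_) (avoid-hole-suc as bs l)

Σ∉-suc : (xs : List (Fin m)) (f : Fin (suc m) → ℕ) →
  Σ∉ (suc m) (map suc xs) f ≡ f zero + Σ∉ m xs (f ∘ suc)
Σ∉-suc {m} xs f = trans (Σ₁-suc m _)
  (cong₂ _+_ (cong (λ b → guard b (f zero)) (avoid-suc-zero xs))
             (Σ₁-cong m (λ l → cong (λ b → guard b (f (suc l))) (avoid-suc xs l))))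

Σ∉-hole : (as bs : List (Fin m)) (f : Fin (suc m) → ℕ) →
  Σ∉ (suc m) (map suc as ++ zero ∷ map suc bs) f ≡ Σ∉ m (as ++ bs) (f ∘ suc)
Σ∉-hole {m} as bs f = trans (Σ₁-suc m _)
  (cong₂ _+_ (cong (λ b → guard b (f zero)) (avoid-hole-zero as bs))
             (Σ₁-cong m (λ l → cong (λ b → guard b (f (suc l))) (avoid-hole-suc as bs l))))

Σ₂-cong : ∀ m {F G : Fin m → Fin m → ℕ} → (∀ i j → F i j ≡ G i j) → Σ₂ m F ≡ Σ₂ m G
Σ₂-cong m eq = Σ₁-cong m λ i → Σ₁-cong m λ j → cong (guard _) (eq i j)

Σ₃-cong : ∀ m {F G : Fin m → Fin m → Fin m → ℕ} → (∀ i j k → F i j k ≡ G i j k) → Σ₃ m F ≡ Σ₃ m G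
Σ₃-cong m eq = Σ₁-cong m λ i → Σ₁-cong m λ j → Σ₁-cong m λ k → cong (guard _) (eq i j k)

Σ₂-+ : ∀ m (F G : Fin m → Fin m → ℕ) → Σ₂ m (λ i j → F i j + G i j) ≡ Σ₂ m F + Σ₂ m G
Σ₂-+ m F G = trans
  (Σ₁-cong m λ i → trans (Σ₁-cong m λ j → guard-+ _ (F i j) (G i j)) (Σ₁-+ m _ _))
  (Σ₁-+ m _ _)

Σ₃-+ : ∀ m (F G : Fin m → Fin m → Fin m → ℕ) → Σ₃ m (λ i j k → F i j k + G i j k) ≡ Σ₃ m F + Σ₃ m G
Σ₃-+ m F G = trans
  (Σ₁-cong m λ i → trans
    (Σ₁-cong m λ j → trans (Σ₁-cong m λ k → guard-+ _ (F i j k) (G i j k)) (Σ₁-+ m _ _))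
    (Σ₁-+ m _ _))
  (Σ₁-+ m _ _)

Σ₂-scale : ∀ m c {F G : Fin m → Fin m → ℕ} → (∀ i j → F i j ≡ c * G i j) → Σ₂ m F ≡ c * Σ₂ m G
Σ₂-scale m c eq = Σ₁-scale m c λ i →
  Σ₁-scale m c λ j → trans (cong (guard _) (eq i j)) (guard-* _ c _)

Σ₃-scale : ∀ m c {F G : Fin m → Fin m → Fin m → ℕ} → (∀ i j k → F i j k ≡ c * G i j k) → Σ₃ m F ≡ c * Σ₃ m G
Σ₃-scale m c eq = Σ₁-scale m c λ i → Σ₁-scale m c λ j →
  Σ₁-scale m c λ k → trans (cong (guard _) (eq i j k)) (guard-* _ c _)

Σ₂-nest : ∀ m (F : Fin m → Fin m → ℕ) → Σ₂ m F ≡ Σ₁ m (λ i → Σ∉ m [ i ] (F i))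
Σ₂-nest m F = Σ₁-cong m λ i → Σ₁-cong m λ j →
  cong (λ b → guard b (F i j)) (sym (∧-identityʳ _))

Σ₃-nest : ∀ m (F : Fin m → Fin m → Fin m → ℕ) →
  Σ₃ m F ≡ Σ₂ m (λ i j → Σ∉ m (i ∷ j ∷ []) (F i j))
Σ₃-nest m F = Σ₁-cong m λ i → Σ₁-cong m λ j → trans
  (Σ₁-cong m λ k → guard-split₃ (i ≠ᶠ j) (i ≠ᶠ k) (j ≠ᶠ k) (F i j k))
  (Σ₁-guard m _ _)

Σ₄-nest : ∀ m (F : Fin m → Fin m → Fin m → Fin m → ℕ) →
  Σ₄ m F ≡ Σ₃ m (λ i j k → Σ∉ m (i ∷ j ∷ k ∷ []) (F i j k))
Σ₄-nest m F = Σ₁-cong m λ i → Σ₁-cong m λ j → Σ₁-cong m λ k → trans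
  (Σ₁-cong m λ l →
    guard-split₄ (i ≠ᶠ j) (i ≠ᶠ k) (i ≠ᶠ l) (j ≠ᶠ k) (j ≠ᶠ l) (k ≠ᶠ l) (F i j k l))
  (Σ₁-guard m _ _)

-- Peeling recurrences: a sum over distinct tuples of Fin (1 + m) splits
-- according to the position holding the index 0, if any.

Σ₂-suc : ∀ m (F : Fin (suc m) → Fin (suc m) → ℕ) →
  Σ₂ (suc m) F ≡ Σ₁ m (λ j → F zero (suc j)) + Σ₁ m (λ i → F (suc i) zero)
               + Σ₂ m (λ i j → F (suc i) (suc j))
Σ₂-suc m F = begin
    Σ₂ (suc m) F
  ≡⟨ Σ₂-nest (suc m) F ⟩
    Σ₁ (suc m) (λ i → Σ∉ (suc m) [ i ] (F i))
  ≡⟨ Σ₁-suc m _ ⟩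
    Σ∉ (suc m) [ zero ] (F zero) + Σ₁ m (λ i → Σ∉ (suc m) [ suc i ] (F (suc i)))
  ≡⟨ cong₂ _+_ (Σ∉-hole [] [] (F zero)) (Σ₁-cong m λ i → Σ∉-suc [ i ] (F (suc i))) ⟩
    Σ₁ m (λ j → F zero (suc j)) + Σ₁ m (λ i → F (suc i) zero + Σ∉ m [ i ] (F (suc i) ∘ suc))
  ≡⟨ cong (Σ₁ m (λ j → F zero (suc j)) +_) (Σ₁-+ m _ _) ⟩
    Σ₁ m (λ j → F zero (suc j)) + (Σ₁ m (λ i → F (suc i) zero) + Σ₁ m (λ i → Σ∉ m [ i ] (F (suc i) ∘ suc)))
  ≡⟨ sym (+-assoc (Σ₁ m (λ j → F zero (suc j))) _ _) ⟩
    Σ₁ m (λ j → F zero (suc j)) + Σ₁ m (λ i → F (suc i) zero) + Σ₁ m (λ i → Σ∉ m [ i ] (F (suc i) ∘ suc))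
  ≡⟨ cong (Σ₁ m (λ j → F zero (suc j)) + Σ₁ m (λ i → F (suc i) zero) +_) (sym (Σ₂-nest m _)) ⟩
    Σ₁ m (λ j → F zero (suc j)) + Σ₁ m (λ i → F (suc i) zero) + Σ₂ m (λ i j → F (suc i) (suc j))
  ∎

Σ₃-suc : ∀ m (F : Fin (suc m) → Fin (suc m) → Fin (suc m) → ℕ) →
  Σ₃ (suc m) F ≡ Σ₂ m (λ j k → F zero (suc j) (suc k)) + Σ₂ m (λ i k → F (suc i) zero (suc k))
               + Σ₂ m (λ i j → F (suc i) (suc j) zero) + Σ₃ m (λ i j k → F (suc i) (suc j) (suc k))
Σ₃-suc m F = begin
    Σ₃ (suc m) F
  ≡⟨ trans (Σ₃-nest (suc m) F) (Σ₂-suc m G) ⟩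
    Σ₁ m (λ j → G zero (suc j)) + Σ₁ m (λ i → G (suc i) zero) + Σ₂ m (λ i j → G (suc i) (suc j))
  ≡⟨ cong₂ _+_ (cong₂ _+_ (Σ₁-cong m λ j → Σ∉-hole [] [ j ] _)
                          (Σ₁-cong m λ i → Σ∉-hole [ i ] [] _))
               (Σ₂-cong m λ i j → Σ∉-suc (i ∷ j ∷ []) _) ⟩
    Σ₁ m (λ j → Σ∉ m [ j ] (F zero (suc j) ∘ suc)) + Σ₁ m (λ i → Σ∉ m [ i ] (F (suc i) zero ∘ suc))
      + Σ₂ m (λ i j → F (suc i) (suc j) zero + Σ∉ m (i ∷ j ∷ []) (F (suc i) (suc j) ∘ suc))
  ≡⟨ cong₂ _+_ (cong₂ _+_ (sym (Σ₂-nest m _)) (sym (Σ₂-nest m _)))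
               (trans (Σ₂-+ m _ _) (cong (Σ₂ m (λ i j → F (suc i) (suc j) zero) +_) (sym (Σ₃-nest m _)))) ⟩
    Σ₂ m (λ j k → F zero (suc j) (suc k)) + Σ₂ m (λ i k → F (suc i) zero (suc k))
      + (Σ₂ m (λ i j → F (suc i) (suc j) zero) + Σ₃ m (λ i j k → F (suc i) (suc j) (suc k)))
  ≡⟨ sym (+-assoc (Σ₂ m (λ j k → F zero (suc j) (suc k)) + Σ₂ m (λ i k → F (suc i) zero (suc k))) _ _) ⟩
    Σ₂ m (λ j k → F zero (suc j) (suc k)) + Σ₂ m (λ i k → F (suc i) zero (suc k))
      + Σ₂ m (λ i j → F (suc i) (suc j) zero) + Σ₃ m (λ i j k → F (suc i) (suc j) (suc k))
  ∎
  where
  G : Fin (suc m) → Fin (suc m) → ℕ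
  G i j = Σ∉ (suc m) (i ∷ j ∷ []) (F i j)

Σ₄-suc : ∀ m (F : Fin (suc m) → Fin (suc m) → Fin (suc m) → Fin (suc m) → ℕ) →
  Σ₄ (suc m) F ≡ Σ₃ m (λ j k l → F zero (suc j) (suc k) (suc l)) + Σ₃ m (λ i k l → F (suc i) zero (suc k) (suc l))
               + Σ₃ m (λ i j l → F (suc i) (suc j) zero (suc l)) + Σ₃ m (λ i j k → F (suc i) (suc j) (suc k) zero)
               + Σ₄ m (λ i j k l → F (suc i) (suc j) (suc k) (suc l))
Σ₄-suc m F = begin
    Σ₄ (suc m) F
  ≡⟨ trans (Σ₄-nest (suc m) F) (Σ₃-suc m G) ⟩
    Σ₂ m (λ j k → G zero (suc j) (suc k)) + Σ₂ m (λ i k → G (suc i) zero (suc k))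
      + Σ₂ m (λ i j → G (suc i) (suc j) zero) + Σ₃ m (λ i j k → G (suc i) (suc j) (suc k))
  ≡⟨ cong₂ _+_ (cong₂ _+_ (cong₂ _+_ (Σ₂-cong m λ j k → Σ∉-hole [] (j ∷ k ∷ []) _)
                                     (Σ₂-cong m λ i k → Σ∉-hole [ i ] [ k ] _))
                          (Σ₂-cong m λ i j → Σ∉-hole (i ∷ j ∷ []) [] _))
               (Σ₃-cong m λ i j k → Σ∉-suc (i ∷ j ∷ k ∷ []) _) ⟩
    Σ₂ m (λ j k → Σ∉ m (j ∷ k ∷ []) (F zero (suc j) (suc k) ∘ suc))
      + Σ₂ m (λ i k → Σ∉ m (i ∷ k ∷ []) (F (suc i) zero (suc k) ∘ suc))
      + Σ₂ m (λ i j → Σ∉ m (i ∷ j ∷ []) (F (suc i) (suc j) zero ∘ suc))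
      + Σ₃ m (λ i j k → F (suc i) (suc j) (suc k) zero + Σ∉ m (i ∷ j ∷ k ∷ []) (F (suc i) (suc j) (suc k) ∘ suc))
  ≡⟨ cong₂ _+_ (cong₂ _+_ (cong₂ _+_ (sym (Σ₃-nest m _)) (sym (Σ₃-nest m _))) (sym (Σ₃-nest m _)))
               (trans (Σ₃-+ m _ _)
                      (cong (Σ₃ m (λ i j k → F (suc i) (suc j) (suc k) zero) +_) (sym (Σ₄-nest m _)))) ⟩
    Σ₃ m (λ j k l → F zero (suc j) (suc k) (suc l)) + Σ₃ m (λ i k l → F (suc i) zero (suc k) (suc l))
      + Σ₃ m (λ i j l → F (suc i) (suc j) zero (suc l))
      + (Σ₃ m (λ i j k → F (suc i) (suc j) (suc k) zero) + Σ₄ m (λ i j k l → F (suc i) (suc j) (suc k) (suc l)))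
  ≡⟨ sym (+-assoc (Σ₃ m (λ j k l → F zero (suc j) (suc k) (suc l)) + Σ₃ m (λ i k l → F (suc i) zero (suc k) (suc l))
                     + Σ₃ m (λ i j l → F (suc i) (suc j) zero (suc l))) _ _) ⟩
    Σ₃ m (λ j k l → F zero (suc j) (suc k) (suc l)) + Σ₃ m (λ i k l → F (suc i) zero (suc k) (suc l))
      + Σ₃ m (λ i j l → F (suc i) (suc j) zero (suc l)) + Σ₃ m (λ i j k → F (suc i) (suc j) (suc k) zero)
      + Σ₄ m (λ i j k l → F (suc i) (suc j) (suc k) (suc l))
  ∎
  where
  G : Fin (suc m) → Fin (suc m) → Fin (suc m) → ℕ
  G i j k = Σ∉ (suc m) (i ∷ j ∷ k ∷ []) (F i j k)

-- Monomial symmetric sums of a sequence a : Fin m → ℕ, e.g.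
-- S₂ f g a = Σ_{i ≠ j} f(a_i) g(a_j).  Every sum in the corollary is of this
-- shape (with f, g, … powers or the identity).

S₁ : (ℕ → ℕ) → (Fin m → ℕ) → ℕ
S₁ {m} f a = Σ₁ m (λ i → f (a i))

S₂ : (ℕ → ℕ) → (ℕ → ℕ) → (Fin m → ℕ) → ℕ
S₂ {m} f g a = Σ₂ m (λ i j → f (a i) * g (a j))

S₃ : (ℕ → ℕ) → (ℕ → ℕ) → (ℕ → ℕ) → (Fin m → ℕ) → ℕ
S₃ {m} f g h a = Σ₃ m (λ i j k → f (a i) * g (a j) * h (a k))

S₄ : (ℕ → ℕ) → (ℕ → ℕ) → (ℕ → ℕ) → (ℕ → ℕ) → (Fin m → ℕ) → ℕ
S₄ {m} f g h k a = Σ₄ m (λ i j k′ l → f (a i) * g (a j) * h (a k′) * k (a l))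

-- Moving the factor contributed by a 0 to the front of a monomial.
*-pull₂ : ∀ p q r → p * q * r ≡ q * (p * r)
*-pull₂ = solve-∀

*-pull₁′ : ∀ p q r s → p * q * r * s ≡ p * (q * r * s)
*-pull₁′ = solve-∀

*-pull₂′ : ∀ p q r s → q * p * r * s ≡ p * (q * r * s)
*-pull₂′ = solve-∀

*-pull₃′ : ∀ p q r s → q * r * p * s ≡ p * (q * r * s)
*-pull₃′ = solve-∀

S₁-suc : (f : ℕ → ℕ) (a : Fin (suc m) → ℕ) → S₁ f a ≡ f (a zero) + S₁ f (a ∘ suc)
S₁-suc {m} f a = Σ₁-suc m (f ∘ a)

S₂-suc : (f g : ℕ → ℕ) (a : Fin (suc m) → ℕ) →
  S₂ f g a ≡ f (a zero) * S₁ g (a ∘ suc) + g (a zero) * S₁ f (a ∘ suc) + S₂ f g (a ∘ suc)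
S₂-suc {m} f g a = trans (Σ₂-suc m λ i j → f (a i) * g (a j)) (cong₂ _+_ (cong₂ _+_
  (Σ₁-scale m (f (a zero)) λ j → refl)
  (Σ₁-scale m (g (a zero)) λ i → *-comm (f (a (suc i))) (g (a zero))))
  refl)

S₃-suc : (f g h : ℕ → ℕ) (a : Fin (suc m) → ℕ) →
  S₃ f g h a ≡ f (a zero) * S₂ g h (a ∘ suc) + g (a zero) * S₂ f h (a ∘ suc)
             + h (a zero) * S₂ f g (a ∘ suc) + S₃ f g h (a ∘ suc)
S₃-suc {m} f g h a = trans (Σ₃-suc m λ i j k′ → f (a i) * g (a j) * h (a k′)) (cong₂ _+_ (cong₂ _+_ (cong₂ _+_
  (Σ₂-scale m (f x) λ j k → *-assoc (f x) (g (a′ j)) (h (a′ k)))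
  (Σ₂-scale m (g x) λ i k → *-pull₂ (f (a′ i)) (g x) (h (a′ k))))
  (Σ₂-scale m (h x) λ i j → *-comm (f (a′ i) * g (a′ j)) (h x)))
  refl)
  where
  x = a zero
  a′ = a ∘ suc

S₄-suc : (f g h k : ℕ → ℕ) (a : Fin (suc m) → ℕ) →
  S₄ f g h k a ≡ f (a zero) * S₃ g h k (a ∘ suc) + g (a zero) * S₃ f h k (a ∘ suc)
               + h (a zero) * S₃ f g k (a ∘ suc) + k (a zero) * S₃ f g h (a ∘ suc)
               + S₄ f g h k (a ∘ suc)
S₄-suc {m} f g h k a = trans (Σ₄-suc m λ i j k′ l → f (a i) * g (a j) * h (a k′) * k (a l)) (cong₂ _+_ (cong₂ _+_ (cong₂ _+_ (cong₂ _+_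
  (Σ₃-scale m (f x) λ j k′ l → *-pull₁′ (f x) (g (a′ j)) (h (a′ k′)) (k (a′ l)))
  (Σ₃-scale m (g x) λ i k′ l → *-pull₂′ (g x) (f (a′ i)) (h (a′ k′)) (k (a′ l))))
  (Σ₃-scale m (h x) λ i j l → *-pull₃′ (h x) (f (a′ i)) (g (a′ j)) (k (a′ l))))
  (Σ₃-scale m (k x) λ i j k′ → *-comm (f (a′ i) * g (a′ j) * h (a′ k′)) (k x)))
  refl)
  where
  x = a zero
  a′ = a ∘ suc

-- The inductive steps as polynomial identities.  Over a′ = a ∘ suc,
-- p = Σ a′_i and p_k = Σ a′_i^k, while q_e is the sum over distinct indices
-- of the monomial with exponent pattern e (e.g. q₂₁ = Σ_{i≠j} a′_i² a′_j);
-- the hypotheses are the expansions for a′.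
module PolynomialIdentities where
  open +-*-Solver

  square-step : ∀ x p p₂ q₁₁ → p₂ + q₁₁ ≡ p ^ 2 →
    (x ^ 2 + p₂) + (x * p + x * p + q₁₁) ≡ (x + p) ^ 2
  square-step x p p₂ q₁₁ h₂ = begin
      (x ^ 2 + p₂) + (x * p + x * p + q₁₁)
    ≡⟨ solve 4 (λ x p p₂ q₁₁ → (x :^ 2 :+ p₂) :+ (x :* p :+ x :* p :+ q₁₁)
                               := x :^ 2 :+ con 2 :* x :* p :+ (p₂ :+ q₁₁)) refl x p p₂ q₁₁ ⟩
      x ^ 2 + 2 * x * p + (p₂ + q₁₁)
    ≡⟨ cong (x ^ 2 + 2 * x * p +_) h₂ ⟩
      x ^ 2 + 2 * x * p + p ^ 2
    ≡⟨ solve 2 (λ x p → x :^ 2 :+ con 2 :* x :* p :+ p :^ 2 := (x :+ p) :^ 2) refl x p ⟩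
      (x + p) ^ 2
    ∎

  cube-step : ∀ x p p₂ p₃ q₁₁ q₂₁ q₁₁₁ → p₂ + q₁₁ ≡ p ^ 2 → p₃ + 3 * q₂₁ + q₁₁₁ ≡ p ^ 3 →
    (x ^ 3 + p₃) + 3 * (x ^ 2 * p + x * p₂ + q₂₁) + (x * q₁₁ + x * q₁₁ + x * q₁₁ + q₁₁₁) ≡ (x + p) ^ 3
  cube-step x p p₂ p₃ q₁₁ q₂₁ q₁₁₁ h₂ h₃ = begin
      (x ^ 3 + p₃) + 3 * (x ^ 2 * p + x * p₂ + q₂₁) + (x * q₁₁ + x * q₁₁ + x * q₁₁ + q₁₁₁)
    ≡⟨ solve 7 (λ x p p₂ p₃ q₁₁ q₂₁ q₁₁₁ →
         (x :^ 3 :+ p₃) :+ con 3 :* (x :^ 2 :* p :+ x :* p₂ :+ q₂₁) :+ (x :* q₁₁ :+ x :* q₁₁ :+ x :* q₁₁ :+ q₁₁₁)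
         := x :^ 3 :+ con 3 :* x :^ 2 :* p :+ con 3 :* x :* (p₂ :+ q₁₁) :+ (p₃ :+ con 3 :* q₂₁ :+ q₁₁₁))
         refl x p p₂ p₃ q₁₁ q₂₁ q₁₁₁ ⟩
      x ^ 3 + 3 * x ^ 2 * p + 3 * x * (p₂ + q₁₁) + (p₃ + 3 * q₂₁ + q₁₁₁)
    ≡⟨ cong₂ (λ s t → x ^ 3 + 3 * x ^ 2 * p + 3 * x * s + t) h₂ h₃ ⟩
      x ^ 3 + 3 * x ^ 2 * p + 3 * x * p ^ 2 + p ^ 3
    ≡⟨ solve 2 (λ x p → x :^ 3 :+ con 3 :* x :^ 2 :* p :+ con 3 :* x :* p :^ 2 :+ p :^ 3 := (x :+ p) :^ 3) refl x p ⟩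
      (x + p) ^ 3
    ∎

  fourth-power-step : ∀ x p p₂ p₃ p₄ q₁₁ q₂₁ q₂₂ q₃₁ q₁₁₁ q₂₁₁ q₁₁₁₁ →
    p₂ + q₁₁ ≡ p ^ 2 → p₃ + 3 * q₂₁ + q₁₁₁ ≡ p ^ 3 →
    p₄ + 3 * q₂₂ + 6 * q₂₁₁ + 4 * q₃₁ + q₁₁₁₁ ≡ p ^ 4 →
    (x ^ 4 + p₄) + 3 * (x ^ 2 * p₂ + x ^ 2 * p₂ + q₂₂) + 6 * (x ^ 2 * q₁₁ + x * q₂₁ + x * q₂₁ + q₂₁₁)
      + 4 * (x ^ 3 * p + x * p₃ + q₃₁) + (x * q₁₁₁ + x * q₁₁₁ + x * q₁₁₁ + x * q₁₁₁ + q₁₁₁₁)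
    ≡ (x + p) ^ 4
  fourth-power-step x p p₂ p₃ p₄ q₁₁ q₂₁ q₂₂ q₃₁ q₁₁₁ q₂₁₁ q₁₁₁₁ h₂ h₃ h₄ = begin
      (x ^ 4 + p₄) + 3 * (x ^ 2 * p₂ + x ^ 2 * p₂ + q₂₂) + 6 * (x ^ 2 * q₁₁ + x * q₂₁ + x * q₂₁ + q₂₁₁)
        + 4 * (x ^ 3 * p + x * p₃ + q₃₁) + (x * q₁₁₁ + x * q₁₁₁ + x * q₁₁₁ + x * q₁₁₁ + q₁₁₁₁)
    ≡⟨ solve 12 (λ x p p₂ p₃ p₄ q₁₁ q₂₁ q₂₂ q₃₁ q₁₁₁ q₂₁₁ q₁₁₁₁ →
         (x :^ 4 :+ p₄) :+ con 3 :* (x :^ 2 :* p₂ :+ x :^ 2 :* p₂ :+ q₂₂)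
           :+ con 6 :* (x :^ 2 :* q₁₁ :+ x :* q₂₁ :+ x :* q₂₁ :+ q₂₁₁)
           :+ con 4 :* (x :^ 3 :* p :+ x :* p₃ :+ q₃₁) :+ (x :* q₁₁₁ :+ x :* q₁₁₁ :+ x :* q₁₁₁ :+ x :* q₁₁₁ :+ q₁₁₁₁)
         := x :^ 4 :+ con 4 :* x :^ 3 :* p :+ con 6 :* x :^ 2 :* (p₂ :+ q₁₁)
           :+ con 4 :* x :* (p₃ :+ con 3 :* q₂₁ :+ q₁₁₁)
           :+ (p₄ :+ con 3 :* q₂₂ :+ con 6 :* q₂₁₁ :+ con 4 :* q₃₁ :+ q₁₁₁₁))
         refl x p p₂ p₃ p₄ q₁₁ q₂₁ q₂₂ q₃₁ q₁₁₁ q₂₁₁ q₁₁₁₁ ⟩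
      x ^ 4 + 4 * x ^ 3 * p + 6 * x ^ 2 * (p₂ + q₁₁) + 4 * x * (p₃ + 3 * q₂₁ + q₁₁₁)
        + (p₄ + 3 * q₂₂ + 6 * q₂₁₁ + 4 * q₃₁ + q₁₁₁₁)
    ≡⟨ cong₂ (λ s t → x ^ 4 + 4 * x ^ 3 * p + 6 * x ^ 2 * s + 4 * x * t + (p₄ + 3 * q₂₂ + 6 * q₂₁₁ + 4 * q₃₁ + q₁₁₁₁)) h₂ h₃ ⟩
      x ^ 4 + 4 * x ^ 3 * p + 6 * x ^ 2 * p ^ 2 + 4 * x * p ^ 3 + (p₄ + 3 * q₂₂ + 6 * q₂₁₁ + 4 * q₃₁ + q₁₁₁₁)
    ≡⟨ cong (x ^ 4 + 4 * x ^ 3 * p + 6 * x ^ 2 * p ^ 2 + 4 * x * p ^ 3 +_) h₄ ⟩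
      x ^ 4 + 4 * x ^ 3 * p + 6 * x ^ 2 * p ^ 2 + 4 * x * p ^ 3 + p ^ 4
    ≡⟨ solve 2 (λ x p → x :^ 4 :+ con 4 :* x :^ 3 :* p :+ con 6 :* x :^ 2 :* p :^ 2 :+ con 4 :* x :* p :^ 3 :+ p :^ 4
                        := (x :+ p) :^ 4) refl x p ⟩
      (x + p) ^ 4
    ∎

open PolynomialIdentities

square-of-sum : ∀ m (a : Fin m → ℕ) → S₁ (_^ 2) a + S₂ id id a ≡ S₁ id a ^ 2
square-of-sum zero    a = refl
square-of-sum (suc m) a = begin
    S₁ (_^ 2) a + S₂ id id a
  ≡⟨ cong₂ _+_ (S₁-suc (_^ 2) a) (S₂-suc id id a) ⟩
    (x ^ 2 + S₁ (_^ 2) a′) + (x * S₁ id a′ + x * S₁ id a′ + S₂ id id a′)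
  ≡⟨ square-step x _ _ _ (square-of-sum m a′) ⟩
    (x + S₁ id a′) ^ 2
  ≡⟨ cong (_^ 2) (sym (S₁-suc id a)) ⟩
    S₁ id a ^ 2
  ∎
  where
  x = a zero
  a′ = a ∘ suc

cube-of-sum : ∀ m (a : Fin m → ℕ) → S₁ (_^ 3) a + 3 * S₂ (_^ 2) id a + S₃ id id id a ≡ S₁ id a ^ 3
cube-of-sum zero    a = refl
cube-of-sum (suc m) a = begin
    S₁ (_^ 3) a + 3 * S₂ (_^ 2) id a + S₃ id id id a
  ≡⟨ cong₂ _+_ (cong₂ _+_ (S₁-suc (_^ 3) a) (cong (3 *_) (S₂-suc (_^ 2) id a))) (S₃-suc id id id a) ⟩
    (x ^ 3 + S₁ (_^ 3) a′) + 3 * (x ^ 2 * S₁ id a′ + x * S₁ (_^ 2) a′ + S₂ (_^ 2) id a′)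
      + (x * S₂ id id a′ + x * S₂ id id a′ + x * S₂ id id a′ + S₃ id id id a′)
  ≡⟨ cube-step x _ _ _ _ _ _ (square-of-sum m a′) (cube-of-sum m a′) ⟩
    (x + S₁ id a′) ^ 3
  ≡⟨ cong (_^ 3) (sym (S₁-suc id a)) ⟩
    S₁ id a ^ 3
  ∎
  where
  x = a zero
  a′ = a ∘ suc

fourth-power-of-sum : ∀ m (a : Fin m → ℕ) →
  S₁ (_^ 4) a + 3 * S₂ (_^ 2) (_^ 2) a + 6 * S₃ (_^ 2) id id a + 4 * S₂ (_^ 3) id a + S₄ id id id id a
    ≡ S₁ id a ^ 4
fourth-power-of-sum zero    a = refl
fourth-power-of-sum (suc m) a = begin
    S₁ (_^ 4) a + 3 * S₂ (_^ 2) (_^ 2) a + 6 * S₃ (_^ 2) id id a + 4 * S₂ (_^ 3) id a + S₄ id id id id a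
  ≡⟨ cong₂ _+_ (cong₂ _+_ (cong₂ _+_ (cong₂ _+_ (S₁-suc (_^ 4) a)
                                                (cong (3 *_) (S₂-suc (_^ 2) (_^ 2) a)))
                                     (cong (6 *_) (S₃-suc (_^ 2) id id a)))
                          (cong (4 *_) (S₂-suc (_^ 3) id a)))
               (S₄-suc id id id id a) ⟩
    (x ^ 4 + S₁ (_^ 4) a′) + 3 * (x ^ 2 * S₁ (_^ 2) a′ + x ^ 2 * S₁ (_^ 2) a′ + S₂ (_^ 2) (_^ 2) a′)
      + 6 * (x ^ 2 * S₂ id id a′ + x * S₂ (_^ 2) id a′ + x * S₂ (_^ 2) id a′ + S₃ (_^ 2) id id a′)
      + 4 * (x ^ 3 * S₁ id a′ + x * S₁ (_^ 3) a′ + S₂ (_^ 3) id a′)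
      + (x * S₃ id id id a′ + x * S₃ id id id a′ + x * S₃ id id id a′ + x * S₃ id id id a′ + S₄ id id id id a′)
  ≡⟨ fourth-power-step x _ _ _ _ _ _ _ _ _ _ _
       (square-of-sum m a′) (cube-of-sum m a′) (fourth-power-of-sum m a′) ⟩
    (x + S₁ id a′) ^ 4
  ≡⟨ cong (_^ 4) (sym (S₁-suc id a)) ⟩
    S₁ id a ^ 4
  ∎
  where
  x = a zero
  a′ = a ∘ suc

square-of-square : ∀ r → (r * r) ^ 2 ≡ r ^ 4
square-of-square r = solve 1 (λ r → (r :* r) :^ 2 := r :^ 4) refl r
  where open +-*-Solver

module _ (G : FinGraph) (r : ℕ) where
  open FinGraph G

  Regular : Set
  Regular = All (λ v → deg G v ≡ r) verts

  -- δ(v) sums deg over the neighbours of v, which are drawn from verts.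
  regular-δ : Regular → ∀ v → deg G v ≡ r → δ G v ≡ r * r
  regular-δ reg v deg-v = begin
      sum (map (deg G) (filterB (adj v) verts))
    ≡⟨ sum-map-const _ (filter⁺ (T? ∘ adj v) reg) ⟩
      deg G v * r
    ≡⟨ cong (_* r) deg-v ⟩
      r * r
    ∎

  regular-MN : Regular → MN G ≡ length verts * r ^ 4
  regular-MN reg = begin
      sum (map (λ v → δ G v ^ 2) verts)
    ≡⟨ sum-map-const verts (All.map (λ {v} deg-v → cong (_^ 2) (regular-δ reg v deg-v)) reg) ⟩
      length verts * (r * r) ^ 2
    ≡⟨ cong (length verts *_) (square-of-square r) ⟩
      length verts * r ^ 4
    ∎

count : (A → Bool) → List A → ℕ
count p l = length (filterB p l)

count-map : (p : B → Bool) (g : A → B) (l : List A) → count p (map g l) ≡ count (p ∘ g) l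
count-map p g []      = refl
count-map p g (x ∷ l) with p (g x)
... | true  = cong suc (count-map p g l)
... | false = count-map p g l

count-concatMap : (p : B → Bool) (f : A → List B) (l : List A) →
  count p (concatMap f l) ≡ sum (map (count p ∘ f) l)
count-concatMap p f []      = refl
count-concatMap p f (x ∷ l) = begin
    length (filterB p (f x ++ concatMap f l))
  ≡⟨ cong length (filter-++ (T? ∘ p) (f x) (concatMap f l)) ⟩
    length (filterB p (f x) ++ filterB p (concatMap f l))
  ≡⟨ length-++ (filterB p (f x)) ⟩
    count p (f x) + count p (concatMap f l)
  ≡⟨ cong (count p (f x) +_) (count-concatMap p f l) ⟩
    count p (f x) + sum (map (count p ∘ f) l)
  ∎

count-none : (l : List A) → count (λ _ → false) l ≡ 0
count-none []      = refl
count-none (_ ∷ l) = count-none l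

length-concatMap : (f : A → List B) (l : List A) → length (concatMap f l) ≡ sum (map (length ∘ f) l)
length-concatMap f []      = refl
length-concatMap f (x ∷ l) = trans (length-++ (f x)) (cong (length (f x) +_) (length-concatMap f l))

sum-applyUpTo-const : ∀ b n → sum (applyUpTo (λ _ → b) n) ≡ n * b
sum-applyUpTo-const b zero    = refl
sum-applyUpTo-const b (suc n) = cong (b +_) (sum-applyUpTo-const b n)

+-left-comm : ∀ a b c → a + (b + c) ≡ b + (a + c)
+-left-comm = solve-∀

sum-spike : ∀ x n a b → x ≤ n → sum (applyUpTo (λ y → if x ≡ᵇ y then a else b) (suc n)) ≡ a + n * b
sum-spike zero    n       a b _         = cong (a +_) (sum-applyUpTo-const b n)
sum-spike (suc x) (suc n) a b (s≤s x≤n) = trans (cong (b +_) (sum-spike x n a b x≤n)) (+-left-comm b a (n * b))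

hammingDegree : Vec ℕ m → ℕ
hammingDegree []       = 0
hammingDegree (n ∷ ns) = (n ∸ 1) + hammingDegree ns

hammingDegree-Σ : (ns : Vec ℕ m) → hammingDegree ns ≡ S₁ id (λ i → lookup ns i ∸ 1)
hammingDegree-Σ []       = refl
hammingDegree-Σ (n ∷ ns) = trans (cong ((n ∸ 1) +_) (hammingDegree-Σ ns)) (sym (S₁-suc id (λ i → lookup (n ∷ ns) i ∸ 1)))

tuples-in-box : (ns : Vec ℕ m) → All (λ v → Pointwise _<_ v ns) (tuples ns)
tuples-in-box []       = [] ∷ []
tuples-in-box (n ∷ ns) = concat⁺ (map⁺ (applyUpTo⁺₁ id n λ b<n →
  map⁺ (All.map (b<n ∷_) (tuples-in-box ns))))

length-tuples : (ns : Vec ℕ m) → length (tuples ns) ≡ product (toList ns)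
length-tuples []       = refl
length-tuples (n ∷ ns) = begin
    length (concatMap (λ b → map (b ∷_) (tuples ns)) (upTo n))
  ≡⟨ length-concatMap _ (upTo n) ⟩
    sum (map (λ b → length (map (b ∷_) (tuples ns))) (upTo n))
  ≡⟨ sum-map-const (upTo n) (All.universal (λ b → trans (length-map (b ∷_) (tuples ns)) (length-tuples ns)) (upTo n)) ⟩
    length (upTo n) * product (toList ns)
  ≡⟨ cong (_* product (toList ns)) (length-upTo n) ⟩
    n * product (toList ns)
  ∎

-- Counting the tuples at distance d from x ∷ xs by their first coordinate b:
-- the layer b = x and each of the n other layers contribute fixed amounts.
count-by-first-coordinate : ∀ {k} {x n d s t} {xs ns : Vec ℕ k} → x ≤ n →
  (∀ b → count (λ w → hdist (x ∷ xs) (b ∷ w) ≡ᵇ d) (tuples ns) ≡ (if x ≡ᵇ b then s else t)) →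
  count (λ w → hdist (x ∷ xs) w ≡ᵇ d) (tuples (suc n ∷ ns)) ≡ s + n * t
count-by-first-coordinate {x = x} {n} {d} {s} {t} {xs} {ns} x≤n layer = begin
    count p (concatMap (λ b → map (b ∷_) (tuples ns)) (upTo (suc n)))
  ≡⟨ count-concatMap p (λ b → map (b ∷_) (tuples ns)) (upTo (suc n)) ⟩
    sum (map (λ b → count p (map (b ∷_) (tuples ns))) (upTo (suc n)))
  ≡⟨ cong sum (map-cong (λ b → trans (count-map p (b ∷_) (tuples ns)) (layer b)) (upTo (suc n))) ⟩
    sum (map (λ b → if x ≡ᵇ b then s else t) (upTo (suc n)))
  ≡⟨ cong sum (map-applyUpTo id _ (suc n)) ⟩
    sum (applyUpTo (λ b → if x ≡ᵇ b then s else t) (suc n))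
  ≡⟨ sum-spike x n s t x≤n ⟩
    s + n * t
  ∎
  where
  p = λ w → hdist (x ∷ xs) w ≡ᵇ d

count-distance-0 : {ns v : Vec ℕ m} → Pointwise _<_ v ns → count (λ w → hdist v w ≡ᵇ 0) (tuples ns) ≡ 1
count-distance-0 [] = refl
count-distance-0 {ns = suc n ∷ ns} {x ∷ xs} (s≤s x≤n ∷ xs<ns) =
  trans (count-by-first-coordinate {xs = xs} {ns} x≤n layer) (cong suc (*-zeroʳ n))
  where
  layer : ∀ b → count (λ w → ((if x ≡ᵇ b then 0 else 1) + hdist xs w) ≡ᵇ 0) (tuples ns)
                ≡ (if x ≡ᵇ b then 1 else 0)
  layer b with x ≡ᵇ b
  ... | true  = count-distance-0 xs<ns
  ... | false = count-none (tuples ns)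

count-distance-1 : {ns v : Vec ℕ m} → Pointwise _<_ v ns →
  count (λ w → hdist v w ≡ᵇ 1) (tuples ns) ≡ hammingDegree ns
count-distance-1 [] = refl
count-distance-1 {ns = suc n ∷ ns} {x ∷ xs} (s≤s x≤n ∷ xs<ns) =
  trans (count-by-first-coordinate {xs = xs} {ns} x≤n layer)
        (trans (cong (hammingDegree ns +_) (*-identityʳ n)) (+-comm (hammingDegree ns) n))
  where
  layer : ∀ b → count (λ w → ((if x ≡ᵇ b then 0 else 1) + hdist xs w) ≡ᵇ 1) (tuples ns)
                ≡ (if x ≡ᵇ b then hammingDegree ns else 1)
  layer b with x ≡ᵇ b
  ... | true  = count-distance-1 xs<ns
  ... | false = count-distance-0 xs<ns

hamming-regular : (ns : Vec ℕ m) → Regular (Hamming ns) (hammingDegree ns)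
hamming-regular ns = All.map count-distance-1 (tuples-in-box ns)

corollary1 : (m : ℕ) → 1 ≤ m → (ns : Vec ℕ m) → (∀ (i : Fin m) → 2 ≤ lookup ns i) →
    MN (Hamming ns) ≡ hammingRHS ns
corollary1 m _ ns _ = begin
    MN (Hamming ns)
  ≡⟨ regular-MN (Hamming ns) (hammingDegree ns) (hamming-regular ns) ⟩
    length (tuples ns) * hammingDegree ns ^ 4
  ≡⟨ cong₂ (λ v d → v * d ^ 4) (length-tuples ns) (hammingDegree-Σ ns) ⟩
    product (toList ns) * S₁ id a ^ 4
  ≡⟨ cong (product (toList ns) *_) (sym (fourth-power-of-sum m a)) ⟩
    hammingRHS ns
  ∎
  where
  a : Fin m → ℕ
  a i = lookup ns i ∸ 1
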